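{- Let $n$ be a positive integer, let $V_l(n)=\{v\in V(n):\Omega(v)=l\}$, and let $E^H_l(n)=\{(a,b)\in E^H(n): a\in V_l(n)\}$. Then for every integer $l$ with $0\le l\le \Omega(n)-1$, $|E^H_l(n)|=|E^H_{\Omega(n)-l-1}(n)|$.
   Context: $V(n)$ is the set of positive divisors of $n$; $\Omega(m)$ is the number of prime factors of $m$ counted with multiplicity. $E^H(n)$ is the arc set of the Hasse diagram $G^H(n)$: the pairs $(a,b)$ with $a,b\in V(n)$, $a<b$, $a\mid b$, such that there is no $c\in V(n)$ with $a<c<b$, $a\mid c$, $c\mid b$ (equivalently, $b/a$ is prime). -}

module Defs where

open import Data.Nat using (ℕ; zero; suc; _<_; _≤?_; _<?_; _≟_)
open import Data.Nat.Divisibility using (_∣_; _∣?_)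
open import Data.Nat.DivMod using (_/_)
open import Data.List using (List; filter; length; upTo; cartesianProduct)
open import Data.List.Relation.Unary.All using (All; all?)
open import Data.Product using (_×_; _,_; proj₁; proj₂)
open import Relation.Nullary using (¬_; yes; no; ¬?)
open import Relation.Nullary.Decidable using (_×-dec_)

-- Ω : number of prime factors counted with multiplicity

leastDivFrom : ℕ → ℕ → ℕ → ℕ
leastDivFrom zero    k m = m
leastDivFrom (suc f) k m with suc k ∣? m
... | yes _ = suc k
... | no  _ = leastDivFrom f (suc k) m

-- quotient of m by its least divisor ≥ 2 (that divisor is prime when m ≥ 2;
-- the search over 2,…,m+1 with fuel m always finds it).
reduce : ℕ → ℕ
reduce zero = zero
reduce (suc m) with leastDivFrom (suc m) 1 (suc m)
... | zero  = zero
... | suc d = suc m / suc d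

Ω-fuel : ℕ → ℕ → ℕ
Ω-fuel zero    m = 0
Ω-fuel (suc f) m with m ≤? 1
... | yes _ = 0
... | no  _ = suc (Ω-fuel f (reduce m))

-- fuel m suffices: each step at least halves m.  Ω 1 = 0.
Ω : ℕ → ℕ
Ω m = Ω-fuel m m

V : ℕ → List ℕ
V n = filter (λ d → (1 ≤? d) ×-dec (d ∣? n)) (upTo (suc n))

Vl : ℕ → ℕ → List ℕ
Vl l n = filter (λ v → Ω v ≟ l) (V n)

Between : ℕ → ℕ → ℕ → Set
Between a b c = (a < c) × ((c < b) × ((a ∣ c) × (c ∣ b)))

IsArc : ℕ → ℕ × ℕ → Set
IsArc n (a , b) = (a < b) × ((a ∣ b) × All (λ c → ¬ Between a b c) (V n))

isArc? : ∀ n e → Relation.Nullary.Dec (IsArc n e)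
isArc? n (a , b) =
  (a <? b) ×-dec ((a ∣? b) ×-dec
    all? (λ c → ¬? ((a <? c) ×-dec ((c <? b) ×-dec ((a ∣? c) ×-dec (c ∣? b))))) (V n))

EH : ℕ → List (ℕ × ℕ)
EH n = filter (isArc? n) (cartesianProduct (V n) (V n))

EHl : ℕ → ℕ → List (ℕ × ℕ)
EHl l n = filter (λ e → Ω (proj₁ e) ≟ l) (EH n)

module Submission where

-- The idea is the duality d ↦ n / d of the divisor lattice of n.  It reverses
-- divisibility, so it maps a cover (a , b) (b / a prime) to the cover
-- (n / b , n / a).  Since Ω is additive, Ω (n / b) = Ω n - Ω b, and for a
-- cover Ω b = Ω a + 1; hence an arc leaving layer j is sent to an arc leaving
-- layer k whenever j + k + 1 = Ω n.  The duality is an involution, so it is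
-- injective on arcs, and comparing lengths in both directions gives equality.

open import Defs
open import Data.Nat
  using (ℕ; zero; suc; _+_; _*_; _∸_; _/_; _≤_; _<_; z≤n; s≤s;
         NonZero; NonTrivial; n>1⇒nonTrivial; nonTrivial⇒n>1; ≢-nonZero⁻¹;
         >-nonZero; >-nonZero⁻¹; z<s)
open import Data.Nat.Properties
open import Data.Nat.Divisibility
open import Data.Nat.DivMod using (m*[n/m]≡n)
open import Data.Nat.Primality
open import Data.Nat.Induction using (<-wellFounded)
open import Induction.WellFounded using (Acc; acc)
open import Data.Product using (Σ; _×_; _,_; proj₁; proj₂)
open import Data.Sum using (inj₁; inj₂)
open import Function using (_∘′_)
open import Relation.Nullary using (¬_; Dec; yes; no; contradiction)
open import Relation.Nullary.Decidable using (_×-dec_)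
open import Relation.Binary.PropositionalEquality
open import Data.List using (List; []; _∷_; length; _++_; upTo; cartesianProduct)
open import Data.List.Properties using (length-++)
open import Data.List.Membership.Propositional using (_∈_)
open import Data.List.Membership.Propositional.Properties
open import Data.List.Relation.Unary.Any using (here; there)
open import Data.List.Relation.Unary.All as All using (All)
open import Data.List.Relation.Unary.Unique.Propositional using (Unique)
open import Data.List.Relation.Unary.AllPairs using ([]; _∷_)
import Data.List.Relation.Unary.Unique.Propositional.Properties as Unique

proper-factor : ∀ {m p r} → 1 < p → 1 ≤ m → m ≡ p * r → 1 ≤ r × r < m
proper-factor {p = p} {r = zero} _ m≥1 refl =
  contradiction (*-zeroʳ p) (≢-nonZero⁻¹ (p * 0) {{>-nonZero m≥1}})
proper-factor {p = p} {r = suc r} p>1 _ refl =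
  s≤s z≤n , subst (suc r <_) (*-comm (suc r) p) (m<m*n (suc r) p p>1)

leastDivFrom-prime : ∀ f j {m} → .{{NonTrivial m}} →
  suc (suc j) Rough m → m ≤ suc (suc j) + f →
  Prime (leastDivFrom f (suc j) m) × leastDivFrom f (suc j) m ∣ m
leastDivFrom-prime zero j {m} rough m≤ =
  rough∧∣⇒prime m-rough ∣-refl , ∣-refl
  where
  m-rough : m Rough m
  m-rough (hasNonTrivialDivisor d<m d∣m) =
    rough (hasNonTrivialDivisor (<-≤-trans d<m (subst (m ≤_) (+-identityʳ _) m≤)) d∣m)
leastDivFrom-prime (suc f) j {m} rough m≤ with suc (suc j) ∣? m
... | yes d∣m = rough∧∣⇒prime rough d∣m , d∣m
... | no  d∤m = leastDivFrom-prime f (suc j) (∤⇒rough-suc d∤m rough)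
                  (subst (m ≤_) (cong suc (+-suc (suc j) f)) m≤)

reduce-spec : ∀ m → .{{NonTrivial m}} → Σ ℕ λ p → Prime p × m ≡ p * reduce m
reduce-spec (suc m)
  with leastDivFrom (suc m) 1 (suc m)
     | leastDivFrom-prime (suc m) 0 {suc m} 2-rough (m≤n+m (suc m) 2)
... | zero  | (p0 , _)  = contradiction refl (≢-nonZero⁻¹ 0 {{prime⇒nonZero p0}})
... | suc d | (p , d∣) = suc d , p , sym (m*[n/m]≡n d∣)

reduce-bounds : ∀ m → .{{NonTrivial m}} → 1 ≤ reduce m × reduce m < m
reduce-bounds m with reduce-spec m
... | p , p-prime , eq =
  proper-factor (nonTrivial⇒n>1 p {{prime⇒nonTrivial p-prime}}) (<-trans z<s (nonTrivial⇒n>1 m)) eq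

Ω-fuel-stable : ∀ f g m → m ≤ f → m ≤ g → Ω-fuel f m ≡ Ω-fuel g m
Ω-fuel-stable zero    zero    zero _ _ = refl
Ω-fuel-stable zero    (suc g) zero _ _ = refl
Ω-fuel-stable (suc f) zero    zero _ _ = refl
Ω-fuel-stable (suc f) (suc g) m m≤f m≤g with m ≤? 1
... | yes _   = refl
... | no  m≰1 = cong suc (Ω-fuel-stable f g (reduce m) (shrink m≤f) (shrink m≤g))
  where
  instance _ = n>1⇒nonTrivial (≰⇒> m≰1)
  shrink : ∀ {h} → m ≤ suc h → reduce m ≤ h
  shrink m≤h = ≤-pred (<-≤-trans (proj₂ (reduce-bounds m)) m≤h)

Ω-reduce : ∀ m → .{{NonTrivial m}} → Ω m ≡ suc (Ω (reduce m))
Ω-reduce m@(suc m-1) with m ≤? 1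
... | yes m≤1 = contradiction m≤1 (<⇒≱ (nonTrivial⇒n>1 m))
... | no  _   = cong suc (Ω-fuel-stable m-1 (reduce m) (reduce m)
                            (≤-pred (proj₂ (reduce-bounds m))) ≤-refl)

prime∣prime⇒≡ : ∀ {p q} → Prime p → Prime q → q ∣ p → q ≡ p
prime∣prime⇒≡ p-prime q-prime q∣p with prime⇒irreducible p-prime q∣p
... | inj₁ refl = contradiction (nonTrivial⇒n>1 1 {{prime⇒nonTrivial q-prime}}) (<-irrefl refl)
... | inj₂ q≡p = q≡p

-- By well-founded induction on m:
-- if reduce strips p from p * m we are done, otherwise it strips a prime
-- q ≠ p that must divide m, and we recurse on m / q.
Ω-prime-*-acc : ∀ {p m} → Acc _<_ m → Prime p → 1 ≤ m → Ω (p * m) ≡ suc (Ω m)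
Ω-prime-*-acc {p} {m} (acc rec) p-prime m≥1
  with reduce-spec (p * m) {{pm-nonTrivial}} | Ω-reduce (p * m) {{pm-nonTrivial}}
  where
  pm-nonTrivial : NonTrivial (p * m)
  pm-nonTrivial = n>1⇒nonTrivial (<-≤-trans (nonTrivial⇒n>1 p {{prime⇒nonTrivial p-prime}})
                    (subst (_≤ p * m) (*-identityʳ p) (*-monoʳ-≤ p m≥1)))
... | q , q-prime , pm≡qr | Ω-pm with q ≟ p
... | yes refl = trans Ω-pm (cong (suc ∘′ Ω) (sym (*-cancelˡ-≡ m _ q {{prime⇒nonZero q-prime}} pm≡qr)))
... | no q≢p with euclidsLemma p m q-prime (divides (reduce (p * m)) (trans pm≡qr (*-comm q _)))
...   | inj₁ q∣p = contradiction (prime∣prime⇒≡ p-prime q-prime q∣p) q≢p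
...   | inj₂ (divides m' m≡m'q) = begin
  Ω (p * m)               ≡⟨ Ω-pm ⟩
  suc (Ω (reduce (p * m))) ≡⟨ cong (suc ∘′ Ω) reduce≡pm' ⟩
  suc (Ω (p * m'))        ≡⟨ cong suc (Ω-prime-*-acc (rec m'<m) p-prime m'≥1) ⟩
  suc (suc (Ω m'))        ≡⟨ cong suc (sym (Ω-prime-*-acc (rec m'<m) q-prime m'≥1)) ⟩
  suc (Ω (q * m'))        ≡⟨ cong (suc ∘′ Ω) (sym m≡qm') ⟩
  suc (Ω m)               ∎
  where
  open ≡-Reasoning
  instance _ = prime⇒nonZero q-prime
  m≡qm' : m ≡ q * m'
  m≡qm' = trans m≡m'q (*-comm m' q)
  m'-bounds : 1 ≤ m' × m' < m
  m'-bounds = proper-factor (nonTrivial⇒n>1 q {{prime⇒nonTrivial q-prime}}) m≥1 m≡qm'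
  m'≥1 : 1 ≤ m'
  m'≥1 = proj₁ m'-bounds
  m'<m : m' < m
  m'<m = proj₂ m'-bounds
  reduce≡pm' : reduce (p * m) ≡ p * m'
  reduce≡pm' = *-cancelˡ-≡ _ _ q (begin
    q * reduce (p * m) ≡⟨ sym pm≡qr ⟩
    p * m              ≡⟨ cong (p *_) m≡qm' ⟩
    p * (q * m')       ≡⟨ *-comm p _ ⟩
    q * m' * p         ≡⟨ *-assoc q m' p ⟩
    q * (m' * p)       ≡⟨ cong (q *_) (*-comm m' p) ⟩
    q * (p * m')       ∎)

Ω-prime-* : ∀ {p m} → Prime p → 1 ≤ m → Ω (p * m) ≡ suc (Ω m)
Ω-prime-* = Ω-prime-*-acc (<-wellFounded _)

Ω-*-acc : ∀ {x} y → Acc _<_ x → 1 ≤ x → 1 ≤ y → Ω (x * y) ≡ Ω x + Ω y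
Ω-*-acc {suc zero} y _ _ _ = cong Ω (+-identityʳ y)
Ω-*-acc {x@(suc (suc _))} y (acc rec) _ y≥1 with reduce-spec x
... | p , p-prime , x≡pr = begin
  Ω (x * y)        ≡⟨ cong (λ z → Ω (z * y)) x≡pr ⟩
  Ω (p * r * y)    ≡⟨ cong Ω (*-assoc p r y) ⟩
  Ω (p * (r * y))  ≡⟨ Ω-prime-* p-prime (*-mono-≤ r≥1 y≥1) ⟩
  suc (Ω (r * y))  ≡⟨ cong suc (Ω-*-acc y (rec r<x) r≥1 y≥1) ⟩
  suc (Ω r + Ω y)  ≡⟨ cong (_+ Ω y) (sym (Ω-reduce x)) ⟩
  Ω x + Ω y        ∎
  where
  open ≡-Reasoning
  r : ℕ
  r = reduce x
  r≥1 : 1 ≤ r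
  r≥1 = proj₁ (reduce-bounds x)
  r<x : r < x
  r<x = proj₂ (reduce-bounds x)

Ω-* : ∀ x y → 1 ≤ x → 1 ≤ y → Ω (x * y) ≡ Ω x + Ω y
Ω-* x y = Ω-*-acc y (<-wellFounded x)

injection-length≤ : ∀ {A B : Set} (f : A → B) {xs : List A} {ys : List B} →
  Unique xs → (∀ {x} → x ∈ xs → f x ∈ ys) →
  (∀ {x y} → x ∈ xs → y ∈ xs → f x ≡ f y → x ≡ y) →
  length xs ≤ length ys
injection-length≤ f {[]} _ _ _ = z≤n
injection-length≤ f {x ∷ xs} {ys} (x∉xs ∷ unique) maps inj
  with ws , zs , refl ← ∈-∃++ (maps (here refl)) =
  subst (suc (length xs) ≤_) (sym length-split)
    (s≤s (injection-length≤ f unique maps-rest (λ p q → inj (there p) (there q))))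
  where
  -- the images of the tail avoid f x, so they lie in ws ++ zs
  maps-rest : ∀ {y} → y ∈ xs → f y ∈ ws ++ zs
  maps-rest {y} y∈xs with ∈-++⁻ ws (maps (there y∈xs))
  ... | inj₁ p = ∈-++⁺ˡ p
  ... | inj₂ (here fy≡fx) = contradiction (inj (here refl) (there y∈xs) (sym fy≡fx)) (All.lookup x∉xs y∈xs)
  ... | inj₂ (there p) = ∈-++⁺ʳ ws p
  length-split : length (ws ++ f x ∷ zs) ≡ suc (length (ws ++ zs))
  length-split = trans (length-++ ws) (trans (+-suc (length ws) _) (cong suc (sym (length-++ ws))))

-- The cofactor n / d of a divisor d (the value at 0 is irrelevant).
cofactor : ℕ → ℕ → ℕ
cofactor n zero    = zero
cofactor n (suc d) = n / suc d

cofactor-* : ∀ {n d} → d ∣ n → d * cofactor n d ≡ n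
cofactor-* {d = zero}  d∣n = sym (0∣⇒≡0 d∣n)
cofactor-* {d = suc _} d∣n = m*[n/m]≡n d∣n

cofactor-∣ : ∀ {n d} → d ∣ n → cofactor n d ∣ n
cofactor-∣ {d = d} d∣n = divides d (sym (cofactor-* d∣n))

module Cofactor (n : ℕ) .{{n≢0 : NonZero n}} where

  divisor-nonZero : ∀ {d} → d ∣ n → NonZero d
  divisor-nonZero {zero} d∣n = contradiction (0∣⇒≡0 d∣n) (≢-nonZero⁻¹ n)
  divisor-nonZero {suc _} _  = _

  cofactor-unique : ∀ {d e} → d * e ≡ n → cofactor n d ≡ e
  cofactor-unique {d} {e} de≡n =
    *-cancelˡ-≡ _ _ d {{divisor-nonZero d∣n}} (trans (cofactor-* d∣n) (sym de≡n))
    where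
    d∣n : d ∣ n
    d∣n = divides e (trans (sym de≡n) (*-comm d e))

  cofactor-involutive : ∀ {d} → d ∣ n → cofactor n (cofactor n d) ≡ d
  cofactor-involutive {d} d∣n = cofactor-unique {cofactor n d} (trans (*-comm _ d) (cofactor-* d∣n))

  cofactor-injective : ∀ {x y} → x ∣ n → y ∣ n → cofactor n x ≡ cofactor n y → x ≡ y
  cofactor-injective x∣n y∣n eq =
    trans (sym (cofactor-involutive x∣n)) (trans (cong (cofactor n) eq) (cofactor-involutive y∣n))

  -- x ∣ y ∣ n  ⇒  n / y ∣ n / x, since n = x * (k * (n / y)) where y = k * x
  cofactor-antitone : ∀ {x y} → x ∣ y → y ∣ n → cofactor n y ∣ cofactor n x
  cofactor-antitone {x} {y} (divides k y≡kx) y∣n = divides k (cofactor-unique {x} (begin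
    x * (k * cofactor n y) ≡⟨ sym (*-assoc x k _) ⟩
    x * k * cofactor n y   ≡⟨ cong (_* cofactor n y) (trans (*-comm x k) (sym y≡kx)) ⟩
    y * cofactor n y       ≡⟨ cofactor-* y∣n ⟩
    n                      ∎))
    where open ≡-Reasoning

  -- strictness follows from injectivity
  cofactor-strictly-antitone : ∀ {x y} → x ∣ y → y ∣ n → x < y → cofactor n y < cofactor n x
  cofactor-strictly-antitone {x} x∣y y∣n x<y =
    ≤∧≢⇒< (∣⇒≤ {{divisor-nonZero (cofactor-∣ x∣n)}} (cofactor-antitone x∣y y∣n))
          (λ eq → <⇒≢ x<y (cofactor-injective x∣n y∣n (sym eq)))
    where
    x∣n : x ∣ n
    x∣n = ∣-trans x∣y y∣n

  -- Ω (n / d) = Ω n - Ω d, stated without truncated subtraction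
  Ω-cofactor : ∀ {d} → d ∣ n → Ω d + Ω (cofactor n d) ≡ Ω n
  Ω-cofactor {d} d∣n = trans (sym (Ω-* d _ (>-nonZero⁻¹ d {{divisor-nonZero d∣n}})
                                          (>-nonZero⁻¹ _ {{divisor-nonZero (cofactor-∣ d∣n)}})))
                             (cong Ω (cofactor-* d∣n))

isPositiveDivisor? : ∀ n d → Dec (1 ≤ d × d ∣ n)
isPositiveDivisor? n d = (1 ≤? d) ×-dec (d ∣? n)

module Membership (n : ℕ) .{{n≢0 : NonZero n}} where
  open Cofactor n

  ∈V⁻ : ∀ {d} → d ∈ V n → d ∣ n
  ∈V⁻ d∈V = proj₂ (proj₂ (∈-filter⁻ (isPositiveDivisor? n) {xs = upTo (suc n)} d∈V))

  ∈V⁺ : ∀ {d} → d ∣ n → d ∈ V n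
  ∈V⁺ {d} d∣n = ∈-filter⁺ (isPositiveDivisor? n) (∈-upTo⁺ (s≤s (∣⇒≤ d∣n)))
                  (>-nonZero⁻¹ d {{divisor-nonZero d∣n}} , d∣n)

  ArcFrom : ℕ → ℕ × ℕ → Set
  ArcFrom k (a , b) = a ∣ n × b ∣ n × IsArc n (a , b) × Ω a ≡ k

  ∈EHl⁻ : ∀ {k e} → e ∈ EHl k n → ArcFrom k e
  ∈EHl⁻ {k} {e} e∈
    with e∈EH , Ωa≡k ← ∈-filter⁻ (λ e → Ω (proj₁ e) ≟ k) {xs = EH n} e∈
    with e∈V² , arc ← ∈-filter⁻ (isArc? n) {xs = cartesianProduct (V n) (V n)} e∈EH
    with a∈V , b∈V ← ∈-cartesianProduct⁻ (V n) (V n) e∈V²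
    = ∈V⁻ a∈V , ∈V⁻ b∈V , arc , Ωa≡k

  ∈EHl⁺ : ∀ {k e} → ArcFrom k e → e ∈ EHl k n
  ∈EHl⁺ {k} (a∣n , b∣n , arc , Ωa≡k) =
    ∈-filter⁺ (λ e → Ω (proj₁ e) ≟ k)
      (∈-filter⁺ (isArc? n) (∈-cartesianProduct⁺ (∈V⁺ a∣n) (∈V⁺ b∣n)) arc) Ωa≡k

EHl-unique : ∀ k n → Unique (EHl k n)
EHl-unique k n =
  Unique.filter⁺ (λ e → Ω (proj₁ e) ≟ k)
    (Unique.filter⁺ (isArc? n) (Unique.cartesianProduct⁺ V-unique V-unique))
  where
  V-unique : Unique (V n)
  V-unique = Unique.filter⁺ (isPositiveDivisor? n) (Unique.upTo⁺ (suc n))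

module Arcs (n : ℕ) .{{n≢0 : NonZero n}} where
  open Cofactor n
  open Membership n

  -- The quotient of a cover is prime: a proper factor e of b / a would give
  -- the divisor a * e strictly between a and b.
  cover-quotient-prime : ∀ {a b t} → b ∣ n → IsArc n (a , b) → b ≡ t * a → Prime t
  cover-quotient-prime {a} {b} {t} b∣n (a<b , a∣b , nothing-between) b≡ta =
    prime {{n>1⇒nonTrivial t>1}} λ (composite {e} e<t e∣t) →
      All.lookup nothing-between (∈V⁺ (∣-trans (ae∣b e∣t) b∣n))
        (m<m*n a e (nonTrivial⇒n>1 e) , ae<b e<t , m∣m*n e , ae∣b e∣t)
    where
    instance _ = divisor-nonZero (∣-trans a∣b b∣n)
    b≡at : b ≡ a * t
    b≡at = trans b≡ta (*-comm t a)
    t>1 : 1 < t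
    t>1 = *-cancelʳ-< a 1 t (subst₂ _<_ (sym (+-identityʳ a)) b≡ta a<b)
    ae<b : ∀ {e} → e < t → a * e < b
    ae<b e<t = subst (_ <_) (sym b≡at) (*-monoʳ-< a e<t)
    ae∣b : ∀ {e} → e ∣ t → a * e ∣ b
    ae∣b e∣t = subst (_ ∣_) (sym b≡at) (*-monoʳ-∣ a e∣t)

  Ω-arc : ∀ {a b} → b ∣ n → IsArc n (a , b) → Ω b ≡ suc (Ω a)
  Ω-arc {a} b∣n arc@(_ , a∣b@(divides t b≡ta) , _) =
    trans (cong Ω b≡ta)
          (Ω-prime-* {t} (cover-quotient-prime b∣n arc b≡ta)
                     (>-nonZero⁻¹ a {{divisor-nonZero (∣-trans a∣b b∣n)}}))

  dual : ℕ × ℕ → ℕ × ℕ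
  dual (a , b) = cofactor n b , cofactor n a

  dual-arc : ∀ {a b} → a ∣ n → b ∣ n → IsArc n (a , b) → IsArc n (dual (a , b))
  dual-arc {a} {b} a∣n b∣n (a<b , a∣b , nothing-between) =
    cofactor-strictly-antitone a∣b b∣n a<b , cofactor-antitone a∣b b∣n ,
    All.tabulate λ c∈V → nothing-between-dual (∈V⁻ c∈V)
    where
    nothing-between-dual : ∀ {c} → c ∣ n → ¬ Between (cofactor n b) (cofactor n a) c
    nothing-between-dual {c} c∣n (cb<c , c<ca , cb∣c , c∣ca) =
      All.lookup nothing-between (∈V⁺ (cofactor-∣ c∣n))
        ( subst (_< cofactor n c) (cofactor-involutive a∣n)
            (cofactor-strictly-antitone c∣ca (cofactor-∣ a∣n) c<ca)
        , subst (cofactor n c <_) (cofactor-involutive b∣n)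
            (cofactor-strictly-antitone cb∣c c∣n cb<c)
        , subst (_∣ cofactor n c) (cofactor-involutive a∣n) (cofactor-antitone c∣ca (cofactor-∣ a∣n))
        , subst (cofactor n c ∣_) (cofactor-involutive b∣n) (cofactor-antitone cb∣c c∣n) )

  dual-∈EHl : ∀ {j k e} → suc (j + k) ≡ Ω n → e ∈ EHl j n → dual e ∈ EHl k n
  dual-∈EHl {j} {k} {a , b} jk≡Ωn e∈ with a∣n , b∣n , arc , Ωa≡j ← ∈EHl⁻ e∈ =
    ∈EHl⁺ (cofactor-∣ b∣n , cofactor-∣ a∣n , dual-arc a∣n b∣n arc , Ω-dual)
    where
    Ω-dual : Ω (cofactor n b) ≡ k
    Ω-dual = +-cancelˡ-≡ (Ω b) _ _ (begin
      Ω b + Ω (cofactor n b) ≡⟨ Ω-cofactor b∣n ⟩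
      Ω n                    ≡⟨ sym jk≡Ωn ⟩
      suc j + k              ≡⟨ cong (λ i → suc i + k) (sym Ωa≡j) ⟩
      suc (Ω a) + k          ≡⟨ cong (_+ k) (sym (Ω-arc b∣n arc)) ⟩
      Ω b + k                ∎)
      where open ≡-Reasoning

  dual-involutive : ∀ {j e} → e ∈ EHl j n → dual (dual e) ≡ e
  dual-involutive e∈ with a∣n , b∣n , _ ← ∈EHl⁻ e∈ =
    cong₂ _,_ (cofactor-involutive a∣n) (cofactor-involutive b∣n)

  EHl-dual-≤ : ∀ {j k} → suc (j + k) ≡ Ω n → length (EHl j n) ≤ length (EHl k n)
  EHl-dual-≤ {j} jk≡Ωn = injection-length≤ dual (EHl-unique j n) (dual-∈EHl jk≡Ωn)
    λ x∈ y∈ eq → trans (sym (dual-involutive x∈)) (trans (cong dual eq) (dual-involutive y∈))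

dual-index : ∀ {N} l → suc l ≤ N → suc (l + (N ∸ l ∸ 1)) ≡ N
dual-index {N} l l<N =
  trans (cong (suc l +_) (trans (∸-+-assoc N l 1) (cong (N ∸_) (+-comm l 1)))) (m+[n∸m]≡n l<N)

theorem5 : (n : ℕ) → .{{_ : NonZero n}} → (l : ℕ) → suc l ≤ Ω n →
    length (EHl l n) ≡ length (EHl (Ω n ∸ l ∸ 1) n)
theorem5 n l l<Ωn =
  ≤-antisym (EHl-dual-≤ l+k+1≡Ωn) (EHl-dual-≤ (trans (cong suc (+-comm _ l)) l+k+1≡Ωn))
  where
  open Arcs n
  l+k+1≡Ωn : suc (l + (Ω n ∸ l ∸ 1)) ≡ Ω n
  l+k+1≡Ωn = dual-index l l<Ωn
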